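{- Let $\mathcal{F}=\langle\mathbb{A},(\mu_i)_{i\in\mathsf{Ag}}\rangle$ be an APE-structure and $\mathbb{E}=(E,(\sim_i),(P_i),\Phi,\mathsf{pre})$ a probabilistic event structure over $\mathbb{A}$. Then for every member $a$ of $\Phi$ and every $i\in\mathsf{Ag}$, the partial function $\mu^a_i$ is an $i$-premeasure on $\mathbb{A}$. Furthermore, if $y\in\mathbb{A}$ and $a\le y$, then $\mu^a_i(x)=\mu^a_i(x\wedge y)$ for every $x$ in the domain of $\mu^a_i$.
   Context: Fix a set $\mathsf{Ag}$ of agents. A monadic Heyting algebra is $\mathbb{A}=\langle\mathbb{L},(\lozenge_i),(\Box_i)\rangle$ with $\mathbb{L}$ a Heyting algebra and monotone unary $\lozenge_i,\Box_i$ such that for all $a,b$: $a\le\lozenge_ia$; $\Box_ia\le a$; $\lozenge_i(a\vee b)\le\lozenge_ia\vee\lozenge_ib$; $\Box_i(a\to b)\le\Box_ia\to\Box_ib$; $\lozenge_ia\le\Box_i\lozenge_ia$; $\lozenge_i\Box_ia\le\Box_ia$; $\Box_i(a\to b)\le\lozenge_ia\to\lozenge_ib$; $\lozenge_i\bot\le\bot$; $\top\le\Box_i\top$. An epistemic Heyting algebra is a finite monadic Heyting algebra with $\lozenge_ia\vee\neg\lozenge_ia=\top$. $a$ is $i$-minimal if $a\neq\bot$, $\lozenge_ia=a$, and $b<a$, $\lozenge_ib=b$ imply $b=\bot$; $\mathsf{Min}_i(\mathbb{A})$ is the set of these, and $X{\downarrow}$ is the downset of $X$. A partial $\mu:\mathbb{A}\to\mathbb{R}_{\ge0}$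 is an $i$-premeasure if (1) its domain is $\mathsf{Min}_i(\mathbb{A}){\downarrow}$; (2) it is order-preserving; (3) for every $a\in\mathsf{Min}_i(\mathbb{A})$ and $b,c\le a$, $\mu(b\vee c)=\mu(b)+\mu(c)-\mu(b\wedge c)$; (4) $\mu(\bot)=0$ if the domain is nonempty. It is an $i$-measure if also (5) $b<c\le a\in\mathsf{Min}_i(\mathbb{A})$ implies $\mu(b)<\mu(c)$, and (6) $\mu(a)=1$ for all $a\in\mathsf{Min}_i(\mathbb{A})$. An APE-structure is $\langle\mathbb{A},(\mu_i)\rangle$ with $\mathbb{A}$ an epistemic Heyting algebra and each $\mu_i$ an $i$-measure. A probabilistic event structure over $\mathbb{A}$ is $(E,(\sim_i),(P_i),\Phi,\mathsf{pre})$: $E$ nonempty finite; $\sim_i$ equivalence relations on $E$; $P_i:E\to(0,1]$ summing to 1 on each $\sim_i$-class; $\Phi$ a finite multiset of elements of $\mathbb{A}$ whose copies of a same element are linearly ordered by $\prec$, such that members arising from distinct elements $a,b$ satisfy $a\wedge b=\bot$, $a<b$ or $b<a$; $\mathsf{pre}(\cdot\mid a)$ a probability distribution on $E$ for each member $a$; and $\mathsf{pre}(e\mid a)=0$ implies $\mathsf{pre}(e\mid b)=0$ whenever $a<b$ or $a\prec b$. For a member $a$ of $\Phi$, $\mathrm{mb}(a)$ is the set of maximal elements among the elements of $\mathbb{A}$ occurring in $\Phi$ that are strictly below $a$, and $\mu^a_i$ is the partial function with the domain of $\mu_i$ given by $\mu^a_i(x)=\mu_i(x\wedge a)-\sum_{b\in\mathrm{mb}(a)}\mu_i(x\wedge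 b)$. -}

module Defs where

open import Level using (0ℓ)
open import Data.Nat using (ℕ; suc)
open import Data.Fin using (Fin) renaming (_<_ to _<ᶠ_)
open import Data.List using (List; foldr; map; length; lookup)
open import Data.List.Relation.Unary.Any using (Any)
open import Data.List.Relation.Unary.AllPairs using (AllPairs)
open import Data.Product using (Σ; ∃; _×_; _,_)
open import Data.Sum using (_⊎_)
open import Relation.Nullary using (¬_)
open import Relation.Binary using (Rel; IsTotalOrder; IsEquivalence)
open import Algebra.Bundles using (CommutativeRing)
open import Relation.Binary.Lattice.Bundles using (HeytingAlgebra)
open import Function.Bundles using (_⇔_)
open import Data.List.Membership.Propositional using (_∈_)
open import Data.List.Relation.Unary.Unique.Propositional using (Unique)

-- The real numbers: since agda-stdlib has no ℝ, the theorem is quantified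
-- over every complete ordered field (classically, all are isomorphic to ℝ).

record RealNumbers : Set₁ where
  field
    commutativeRing : CommutativeRing 0ℓ 0ℓ
  open CommutativeRing commutativeRing public
  infix 4 _≤ℝ_ _<ℝ_
  field
    _≤ℝ_         : Rel Carrier 0ℓ
    isTotalOrder : IsTotalOrder _≈_ _≤ℝ_
    +-mono-≤     : ∀ {x y} z → x ≤ℝ y → x + z ≤ℝ y + z
    *-nonneg     : ∀ {x y} → 0# ≤ℝ x → 0# ≤ℝ y → 0# ≤ℝ x * y
    nontrivial   : ¬ (1# ≈ 0#)
    inverse      : ∀ x → ¬ (x ≈ 0#) → ∃ λ y → x * y ≈ 1#
    complete     : (P : Carrier → Set) → (∃ λ x → P x) →
                   (∃ λ u → ∀ x → P x → x ≤ℝ u) →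
                   ∃ λ s → (∀ x → P x → x ≤ℝ s) ×
                           (∀ u → (∀ x → P x → x ≤ℝ u) → s ≤ℝ u)

  _<ℝ_ : Rel Carrier 0ℓ
  x <ℝ y = (x ≤ℝ y) × ¬ (x ≈ y)

  sumℝ : List Carrier → Carrier
  sumℝ = foldr _+_ 0#

record MonadicHA (Ag : Set) : Set₁ where
  field
    HA : HeytingAlgebra 0ℓ 0ℓ 0ℓ
  open HeytingAlgebra HA public
  field
    ◇ : Ag → Carrier → Carrier
    □ : Ag → Carrier → Carrier
    ◇-mono : ∀ i {a b} → a ≤ b → ◇ i a ≤ ◇ i b
    □-mono : ∀ i {a b} → a ≤ b → □ i a ≤ □ i b
    ax1 : ∀ i a → a ≤ ◇ i a
    ax2 : ∀ i a → □ i a ≤ a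
    ax3 : ∀ i a b → ◇ i (a ∨ b) ≤ ◇ i a ∨ ◇ i b
    ax4 : ∀ i a b → □ i (a ⇨ b) ≤ (□ i a ⇨ □ i b)
    ax5 : ∀ i a → ◇ i a ≤ □ i (◇ i a)
    ax6 : ∀ i a → ◇ i (□ i a) ≤ □ i a
    ax7 : ∀ i a b → □ i (a ⇨ b) ≤ (◇ i a ⇨ ◇ i b)
    ax8 : ∀ i → ◇ i ⊥ ≤ ⊥
    ax9 : ∀ i → ⊤ ≤ □ i ⊤

  ¬ₕ_ : Carrier → Carrier
  ¬ₕ a = a ⇨ ⊥

  _<_ : Carrier → Carrier → Set
  a < b = (a ≤ b) × ¬ (a ≈ b)

  IsMin : Ag → Carrier → Set
  IsMin i a = ¬ (a ≈ ⊥) × (◇ i a ≈ a) ×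
              (∀ b → b < a → ◇ i b ≈ b → b ≈ ⊥)

  InMinDown : Ag → Carrier → Set
  InMinDown i x = ∃ λ a → IsMin i a × x ≤ a

record EpistemicHA (Ag : Set) : Set₁ where
  field
    monadic : MonadicHA Ag
  open MonadicHA monadic public
  field
    finite    : ∃ λ (xs : List Carrier) → ∀ x → Any (x ≈_) xs
    epistemic : ∀ i a → ◇ i a ∨ ¬ₕ (◇ i a) ≈ ⊤

-- A partial map A ⇀ ℝ≥0 whose domain is
-- Min_i(A)↓ (condition (1)) is represented by a total map A → ℝ of which
-- only the values on Min_i(A)↓ matter; all conditions quantify over that
-- domain only.

module _ {Ag : Set} (R : RealNumbers) (𝔸 : EpistemicHA Ag) where
  private
    module ℝ = RealNumbers R
  open EpistemicHA 𝔸

  record IsPremeasure (i : Ag) (μ : Carrier → ℝ.Carrier) : Set where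
    field
      well-defined : ∀ {x y} → InMinDown i x → x ≈ y → μ x ℝ.≈ μ y
      nonneg        : ∀ x → InMinDown i x → ℝ.0# ℝ.≤ℝ μ x
      order-pres    : ∀ x y → InMinDown i x → InMinDown i y →
                      x ≤ y → μ x ℝ.≤ℝ μ y
      modular       : ∀ a b c → IsMin i a → b ≤ a → c ≤ a →
                      μ (b ∨ c) ℝ.≈ (μ b ℝ.+ μ c) ℝ.- μ (b ∧ c)
      bot-zero      : (∃ λ x → InMinDown i x) → μ ⊥ ℝ.≈ ℝ.0#

  record IsMeasure (i : Ag) (μ : Carrier → ℝ.Carrier) : Set where
    field
      isPremeasure : IsPremeasure i μ
      strict       : ∀ a b c → IsMin i a → b < c → c ≤ a → μ b ℝ.<ℝ μ c
      normalised   : ∀ a → IsMin i a → μ a ℝ.≈ ℝ.1#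

  record APE : Set where
    field
      μ         : Ag → Carrier → ℝ.Carrier
      isMeasure : ∀ i → IsMeasure i (μ i)

  -- E = Fin n with n ≥ 1 (nonempty, finite).
  -- Φ is a list of elements of A; members of Φ are positions k : Fin (length Φ);
  -- the linear order ≺ on copies of the same element is the list order.

  record ProbEventStructure : Set₁ where
    field
      n     : ℕ
      nonempty : Fin n
      _∼_   : Ag → Rel (Fin n) 0ℓ
      ∼-equiv : ∀ i → IsEquivalence (_∼_ i)
      P     : Ag → Fin n → ℝ.Carrier
      P-pos : ∀ i e → ℝ.0# ℝ.<ℝ P i e
      P-le1 : ∀ i e → P i e ℝ.≤ℝ ℝ.1#
      P-sum : ∀ i e (l : List (Fin n)) → Unique l →
              (∀ e′ → (e′ ∈ l) ⇔ (_∼_ i e e′)) →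
              ℝ.sumℝ (map (P i) l) ℝ.≈ ℝ.1#
      Φ     : List Carrier
      Φ-ok  : ∀ (k l : Fin (length Φ)) → ¬ (lookup Φ k ≈ lookup Φ l) →
              ((lookup Φ k ∧ lookup Φ l) ≈ ⊥) ⊎
              (lookup Φ k < lookup Φ l) ⊎ (lookup Φ l < lookup Φ k)
      pre   : Fin (length Φ) → Fin n → ℝ.Carrier
      pre-nonneg : ∀ k e → ℝ.0# ℝ.≤ℝ pre k e
      pre-le1    : ∀ k e → pre k e ℝ.≤ℝ ℝ.1#
      pre-sum    : ∀ k (l : List (Fin n)) → Unique l → (∀ e → e ∈ l) →
                   ℝ.sumℝ (map (pre k) l) ℝ.≈ ℝ.1#
      pre-zero   : ∀ (k l : Fin (length Φ)) e →
                   ((lookup Φ k < lookup Φ l) ⊎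
                    ((lookup Φ k ≈ lookup Φ l) × (k <ᶠ l))) →
                   pre k e ℝ.≈ ℝ.0# → pre l e ℝ.≈ ℝ.0#

    Occurs : Carrier → Set
    Occurs c = ∃ λ k → lookup Φ k ≈ c

    InMb : Carrier → Carrier → Set
    InMb a b = Occurs b × b < a × (∀ c → Occurs c → c < a → ¬ (b < c))

  Enumerates : (Carrier → Set) → List Carrier → Set
  Enumerates S bs = AllPairs (λ b c → ¬ (b ≈ c)) bs ×
                    (∀ b → S b ⇔ Any (b ≈_) bs)

  -- μ^a_i(x) = μ_i(x ∧ a) − Σ_{b ∈ mb(a)} μ_i(x ∧ b), where bs enumerates mb(a)
  μ^ : (Carrier → ℝ.Carrier) → Carrier → List Carrier → Carrier → ℝ.Carrier
  μ^ μ a bs x = μ (x ∧ a) ℝ.- ℝ.sumℝ (map (λ b → μ (x ∧ b)) bs)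

-- Because the maximal elements of Φ below a are pairwise disjoint, the sum
-- Σ_{b ∈ mb(a)} μ_i(x ∧ b) equals μ_i(x ∧ B) for their join B ≤ a. Hence
-- μ^a_i(x) = μ_i(x ∧ a) − μ_i(x ∧ B), a difference of two restrictions of μ_i.
-- Restrictions x ↦ μ_i(x ∧ c) are premeasures by distributivity, and so is the
-- difference: monotonicity follows from modularity applied to (x ∧ a) ∨ (y ∧ B).
-- Since a ∧ y = a and B ∧ y = B whenever a ≤ y, this form also gives the second claim.
module Submission where

open import Defs
open import Data.List using (List; length; lookup)
open import Data.Fin using (Fin)
open import Data.Product using (_×_)

open import Level using (0ℓ)
open import Data.List using ([]; _∷_; foldr; map)
open import Data.List.Relation.Unary.All as All using (All; []; _∷_)
open import Data.List.Relation.Unary.AllPairs using (AllPairs; []; _∷_)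
open import Data.Maybe using (nothing)
open import Data.Product using (_,_; proj₁; proj₂; ∃)
open import Data.Sum using (inj₁; inj₂)
open import Data.Empty using (⊥-elim)
open import Function.Base using (_∘_)
open import Function.Bundles using (Equivalence)
open import Relation.Nullary using (¬_)
open import Relation.Binary.Bundles using (Poset)
open import Relation.Binary.Structures using (IsTotalOrder)
open import Relation.Binary.Lattice.Bundles using (HeytingAlgebra)
open import Tactic.RingSolver using (solve-∀)
open import Tactic.RingSolver.Core.AlmostCommutativeRing
  using (AlmostCommutativeRing; fromCommutativeRing)
import Relation.Binary.Reasoning.Setoid as ≈-Reasoning
import Relation.Binary.Reasoning.PartialOrder as ≤-Reasoning

-- The solver cannot cancel x − x over ℝ (it has no decision procedure for 0 ≈ c),
-- so only identities free of cancellation are proved by it.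
module RingIdentities (R : RealNumbers) where
  ℝ-ring : AlmostCommutativeRing 0ℓ 0ℓ
  ℝ-ring = fromCommutativeRing (RealNumbers.commutativeRing R) (λ _ → nothing)

  open AlmostCommutativeRing ℝ-ring

  [x+y-z]-y≈[x-z+y]-y : ∀ x y z → ((x + y) - z) - y ≈ ((x - z) + y) - y
  [x+y-z]-y≈[x-z+y]-y = solve-∀ ℝ-ring

  [x+y-z]-[u+v-w]≈[x-u]+[y-v]-[z-w] : ∀ x y z u v w →
    ((x + y) - z) - ((u + v) - w) ≈ ((x - u) + (y - v)) - (z - w)
  [x+y-z]-[u+v-w]≈[x-u]+[y-v]-[z-w] = solve-∀ ℝ-ring

module RealArithmetic (R : RealNumbers) where
  open RealNumbers R
  open import Algebra.Properties.Group +-group using (ε⁻¹≈ε; //-rightDividesʳ)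
  open RingIdentities R public using ([x+y-z]-[u+v-w]≈[x-u]+[y-v]-[z-w])

  x-0≈x : ∀ x → x - 0# ≈ x
  x-0≈x x = trans (+-cong refl ε⁻¹≈ε) (+-identityʳ x)

  [x+y-z]-y≈x-z : ∀ x y z → ((x + y) - z) - y ≈ x - z
  [x+y-z]-y≈x-z x y z =
    trans (RingIdentities.[x+y-z]-y≈[x-z+y]-y R x y z) (//-rightDividesʳ y (x - z))

  ≤-poset : Poset 0ℓ 0ℓ 0ℓ
  ≤-poset = record { isPartialOrder = IsTotalOrder.isPartialOrder isTotalOrder }

  open Poset ≤-poset public using (≤-respˡ-≈; ≤-respʳ-≈)

  x≤y⇒0≤y-x : ∀ {x y} → x ≤ℝ y → 0# ≤ℝ y - x
  x≤y⇒0≤y-x {x} x≤y = ≤-respˡ-≈ (-‿inverseʳ x) (+-mono-≤ (- x) x≤y)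

module LatticeProperties (L : HeytingAlgebra 0ℓ 0ℓ 0ℓ) where
  open HeytingAlgebra L
  open import Relation.Binary.Lattice.Properties.HeytingAlgebra L using (distributiveLattice)
  open import Relation.Binary.Lattice.Properties.HeytingAlgebra L public using (∧-distribˡ-∨)
  open import Relation.Binary.Lattice.Properties.DistributiveLattice distributiveLattice
    public using (∧-distribʳ-∨)
  open import Relation.Binary.Lattice.Properties.MeetSemilattice meetSemilattice
    public using (∧-monotonic; ∧-cong; y≤x⇒x∧y≈y; ∧-assoc)

  ⋁ : List Carrier → Carrier
  ⋁ = foldr _∨_ ⊥

  Disjoint : Carrier → Carrier → Set
  Disjoint b c = b ∧ c ≤ ⊥

  ⋁-least : ∀ {a cs} → All (_≤ a) cs → ⋁ cs ≤ a
  ⋁-least {a} []             = minimum a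
  ⋁-least     (c≤a ∷ cs≤a) = ∨-least c≤a (⋁-least cs≤a)

  disjoint-⋁ : ∀ {b cs} → All (Disjoint b) cs → Disjoint b (⋁ cs)
  disjoint-⋁ []           = x∧y≤y _ _
  disjoint-⋁ {b} {c ∷ cs} (b⊥c ∷ b⊥cs) =
    trans (reflexive (∧-distribˡ-∨ b c (⋁ cs))) (∨-least b⊥c (disjoint-⋁ b⊥cs))

  ∧-distribʳ-∧ : ∀ x y z → (x ∧ y) ∧ z ≈ (x ∧ z) ∧ (y ∧ z)
  ∧-distribʳ-∧ x y z = antisym
    (∧-greatest (∧-monotonic (x∧y≤x x y) refl) (∧-monotonic (x∧y≤y x y) refl))
    (∧-greatest (∧-monotonic (x∧y≤x x z) (x∧y≤x y z)) (trans (x∧y≤x _ _) (x∧y≤y x z)))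

  x∧c≈[x∧y]∧c : ∀ {x y c} → c ≤ y → x ∧ c ≈ (x ∧ y) ∧ c
  x∧c≈[x∧y]∧c {x} {y} {c} c≤y = Eq.trans
    (∧-cong Eq.refl (Eq.sym (y≤x⇒x∧y≈y c≤y)))
    (Eq.sym (∧-assoc x y c))

  [x∧a]∧[y∧b]≈x∧b : ∀ {x y a b} → x ≤ y → b ≤ a → (x ∧ a) ∧ (y ∧ b) ≈ x ∧ b
  [x∧a]∧[y∧b]≈x∧b x≤y b≤a = antisym
    (∧-monotonic (x∧y≤x _ _) (x∧y≤y _ _))
    (∧-greatest (∧-monotonic refl b≤a) (∧-monotonic x≤y refl))

module PremeasureProperties {Ag : Set} (R : RealNumbers) (𝔸 : EpistemicHA Ag) (i : Ag) where
  open EpistemicHA 𝔸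
  open LatticeProperties HA
  private
    module ℝ where
      open RealNumbers R public
      open RealArithmetic R public

  InMinDown-≤ : ∀ {x y} → y ≤ x → InMinDown i x → InMinDown i y
  InMinDown-≤ y≤x (m , m-min , x≤m) = m , m-min , trans y≤x x≤m

  isPremeasure-cong : ∀ {f g : Carrier → ℝ.Carrier} →
    (∀ {x} → InMinDown i x → f x ℝ.≈ g x) →
    IsPremeasure R 𝔸 i f → IsPremeasure R 𝔸 i g
  isPremeasure-cong {f} {g} f≈g pm = record
    { well-defined = λ dx x≈y → ℝ.trans (ℝ.sym (f≈g dx))
        (ℝ.trans (well-defined dx x≈y) (f≈g (InMinDown-≤ (reflexive (Eq.sym x≈y)) dx)))
    ; nonneg       = λ x dx → ℝ.≤-respʳ-≈ (f≈g dx) (nonneg x dx)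
    ; order-pres   = λ x y dx dy x≤y →
        ℝ.≤-respˡ-≈ (f≈g dx) (ℝ.≤-respʳ-≈ (f≈g dy) (order-pres x y dx dy x≤y))
    ; modular      = g-modular
    ; bot-zero     = λ { (z , dz) →
        ℝ.trans (ℝ.sym (f≈g (InMinDown-≤ (minimum z) dz))) (bot-zero (z , dz)) }
    }
    where
    open IsPremeasure pm
    g-modular : ∀ a b c → IsMin i a → b ≤ a → c ≤ a →
                g (b ∨ c) ℝ.≈ (g b ℝ.+ g c) ℝ.- g (b ∧ c)
    g-modular a b c a-min b≤a c≤a = begin
      g (b ∨ c)                      ≈⟨ ℝ.sym (f≈g (a , a-min , ∨-least b≤a c≤a)) ⟩
      f (b ∨ c)                      ≈⟨ modular a b c a-min b≤a c≤a ⟩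
      (f b ℝ.+ f c) ℝ.- f (b ∧ c)    ≈⟨ ℝ.+-cong (ℝ.+-cong (f≈g (a , a-min , b≤a)) (f≈g (a , a-min , c≤a)))
                                          (ℝ.-‿cong (f≈g (a , a-min , trans (x∧y≤x b c) b≤a))) ⟩
      (g b ℝ.+ g c) ℝ.- g (b ∧ c)    ∎
      where open ≈-Reasoning ℝ.setoid

  module _ {μ : Carrier → ℝ.Carrier} (pm : IsPremeasure R 𝔸 i μ) where
    open IsPremeasure pm

    μ-≤⊥ : ∀ {w} → ∃ (InMinDown i) → w ≤ ⊥ → μ w ℝ.≈ ℝ.0#
    μ-≤⊥ (z , dz) w≤⊥ = ℝ.trans
      (well-defined (InMinDown-≤ (trans w≤⊥ (minimum z)) dz) (antisym w≤⊥ (minimum _)))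
      (bot-zero (z , dz))

    μ-∧-⋁ : ∀ {z} cs → AllPairs Disjoint cs → InMinDown i z →
            μ (z ∧ ⋁ cs) ℝ.≈ ℝ.sumℝ (map (λ c → μ (z ∧ c)) cs)
    μ-∧-⋁ []       []                   dz = μ-≤⊥ (_ , dz) (x∧y≤y _ _)
    μ-∧-⋁ {z} (c ∷ cs) (c⊥cs ∷ cs-disj) dz@(m , m-min , z≤m) = begin
      μ (z ∧ (c ∨ ⋁ cs))
        ≈⟨ well-defined (InMinDown-≤ (x∧y≤x _ _) dz) (∧-distribˡ-∨ z c (⋁ cs)) ⟩
      μ ((z ∧ c) ∨ (z ∧ ⋁ cs))
        ≈⟨ modular m _ _ m-min (trans (x∧y≤x _ _) z≤m) (trans (x∧y≤x _ _) z≤m) ⟩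
      (μ (z ∧ c) ℝ.+ μ (z ∧ ⋁ cs)) ℝ.- μ ((z ∧ c) ∧ (z ∧ ⋁ cs))
        ≈⟨ ℝ.+-cong ℝ.refl (ℝ.-‿cong (μ-≤⊥ (_ , dz) z∧c⊥z∧⋁cs)) ⟩
      (μ (z ∧ c) ℝ.+ μ (z ∧ ⋁ cs)) ℝ.- ℝ.0#
        ≈⟨ ℝ.x-0≈x _ ⟩
      μ (z ∧ c) ℝ.+ μ (z ∧ ⋁ cs)
        ≈⟨ ℝ.+-cong ℝ.refl (μ-∧-⋁ cs cs-disj dz) ⟩
      μ (z ∧ c) ℝ.+ ℝ.sumℝ (map (λ c → μ (z ∧ c)) cs) ∎
      where
      open ≈-Reasoning ℝ.setoid
      z∧c⊥z∧⋁cs : Disjoint (z ∧ c) (z ∧ ⋁ cs)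
      z∧c⊥z∧⋁cs = trans (∧-monotonic (x∧y≤y _ _) (x∧y≤y _ _)) (disjoint-⋁ c⊥cs)

    μ-∧-absorb : ∀ {x y c} → c ≤ y → InMinDown i x → μ (x ∧ c) ℝ.≈ μ ((x ∧ y) ∧ c)
    μ-∧-absorb c≤y dx = well-defined (InMinDown-≤ (x∧y≤x _ _) dx) (x∧c≈[x∧y]∧c c≤y)

    ∧-isPremeasure : ∀ c → IsPremeasure R 𝔸 i (λ x → μ (x ∧ c))
    ∧-isPremeasure c = record
      { well-defined = λ dx x≈y → well-defined (↓∧ dx) (∧-cong x≈y Eq.refl)
      ; nonneg       = λ x dx → nonneg (x ∧ c) (↓∧ dx)
      ; order-pres   = λ x y dx dy x≤y → order-pres _ _ (↓∧ dx) (↓∧ dy) (∧-monotonic x≤y refl)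
      ; modular      = ∧c-modular
      ; bot-zero     = λ d → μ-≤⊥ d (x∧y≤x ⊥ c)
      }
      where
      ↓∧ : ∀ {x} → InMinDown i x → InMinDown i (x ∧ c)
      ↓∧ = InMinDown-≤ (x∧y≤x _ _)
      ∧c-modular : ∀ a b d → IsMin i a → b ≤ a → d ≤ a →
        μ ((b ∨ d) ∧ c) ℝ.≈ (μ (b ∧ c) ℝ.+ μ (d ∧ c)) ℝ.- μ ((b ∧ d) ∧ c)
      ∧c-modular a b d a-min b≤a d≤a = begin
        μ ((b ∨ d) ∧ c)
          ≈⟨ well-defined (↓∧ (a , a-min , ∨-least b≤a d≤a)) (∧-distribʳ-∨ c b d) ⟩
        μ ((b ∧ c) ∨ (d ∧ c))
          ≈⟨ modular a _ _ a-min (trans (x∧y≤x _ _) b≤a) (trans (x∧y≤x _ _) d≤a) ⟩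
        (μ (b ∧ c) ℝ.+ μ (d ∧ c)) ℝ.- μ ((b ∧ c) ∧ (d ∧ c))
          ≈⟨ ℝ.+-cong ℝ.refl (ℝ.-‿cong (ℝ.sym
               (well-defined (↓∧ (a , a-min , trans (x∧y≤x _ _) b≤a)) (∧-distribʳ-∧ b d c)))) ⟩
        (μ (b ∧ c) ℝ.+ μ (d ∧ c)) ℝ.- μ ((b ∧ d) ∧ c) ∎
        where open ≈-Reasoning ℝ.setoid

    ∧-difference-isPremeasure : ∀ {a b} → b ≤ a →
      IsPremeasure R 𝔸 i (λ x → μ (x ∧ a) ℝ.- μ (x ∧ b))
    ∧-difference-isPremeasure {a} {b} b≤a = record
      { well-defined = λ dx x≈y →
          ℝ.+-cong (μa.well-defined dx x≈y) (ℝ.-‿cong (μb.well-defined dx x≈y))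
      ; nonneg       = λ x dx → ℝ.x≤y⇒0≤y-x (order-pres _ _ (↓∧ dx) (↓∧ dx) (∧-monotonic refl b≤a))
      ; order-pres   = monotone
      ; modular      = λ m x y m-min x≤m y≤m → ℝ.trans
          (ℝ.+-cong (μa.modular m x y m-min x≤m y≤m) (ℝ.-‿cong (μb.modular m x y m-min x≤m y≤m)))
          (ℝ.[x+y-z]-[u+v-w]≈[x-u]+[y-v]-[z-w] _ _ _ _ _ _)
      ; bot-zero     = λ d → ℝ.trans
          (ℝ.+-cong (μa.bot-zero d) (ℝ.-‿cong (μb.bot-zero d))) (ℝ.-‿inverseʳ ℝ.0#)
      }
      where
      module μa = IsPremeasure (∧-isPremeasure a)
      module μb = IsPremeasure (∧-isPremeasure b)
      ↓∧ : ∀ {x c} → InMinDown i x → InMinDown i (x ∧ c)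
      ↓∧ = InMinDown-≤ (x∧y≤x _ _)
      monotone : ∀ x y → InMinDown i x → InMinDown i y → x ≤ y →
        μ (x ∧ a) ℝ.- μ (x ∧ b) ℝ.≤ℝ μ (y ∧ a) ℝ.- μ (y ∧ b)
      monotone x y dx dy@(m , m-min , y≤m) x≤y = begin
        μ (x ∧ a) ℝ.- μ (x ∧ b)
          ≈⟨ ℝ.sym (ℝ.[x+y-z]-y≈x-z _ _ _) ⟩
        ((μ (x ∧ a) ℝ.+ μ (y ∧ b)) ℝ.- μ (x ∧ b)) ℝ.- μ (y ∧ b)
          ≈⟨ ℝ.+-cong (ℝ.sym μu) ℝ.refl ⟩
        μ u ℝ.- μ (y ∧ b)
          ≤⟨ ℝ.+-mono-≤ _ (order-pres u (y ∧ a) (InMinDown-≤ u≤y∧a (↓∧ dy)) (↓∧ dy) u≤y∧a) ⟩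
        μ (y ∧ a) ℝ.- μ (y ∧ b) ∎
        where
        open ≤-Reasoning ℝ.≤-poset
        u : Carrier
        u = (x ∧ a) ∨ (y ∧ b)
        u≤y∧a : u ≤ y ∧ a
        u≤y∧a = ∨-least (∧-monotonic x≤y refl) (∧-monotonic refl b≤a)
        μu : μ u ℝ.≈ (μ (x ∧ a) ℝ.+ μ (y ∧ b)) ℝ.- μ (x ∧ b)
        μu = ℝ.trans
          (modular m _ _ m-min (trans (x∧y≤x _ _) (trans x≤y y≤m)) (trans (x∧y≤x _ _) y≤m))
          (ℝ.+-cong ℝ.refl (ℝ.-‿cong
            (well-defined (InMinDown-≤ (x∧y≤y _ _) (↓∧ dy)) ([x∧a]∧[y∧b]≈x∧b x≤y b≤a))))

    module μ^-Properties {a : Carrier} {bs : List Carrier}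
        (bs-disjoint : AllPairs Disjoint bs) (bs≤a : All (_≤ a) bs) where

      μ^≈difference : ∀ {x} → InMinDown i x →
        μ^ R 𝔸 μ a bs x ℝ.≈ μ (x ∧ a) ℝ.- μ (x ∧ ⋁ bs)
      μ^≈difference dx = ℝ.+-cong ℝ.refl (ℝ.-‿cong (ℝ.sym (μ-∧-⋁ bs bs-disjoint dx)))

      μ^-isPremeasure : IsPremeasure R 𝔸 i (μ^ R 𝔸 μ a bs)
      μ^-isPremeasure = isPremeasure-cong (ℝ.sym ∘ μ^≈difference)
        (∧-difference-isPremeasure (⋁-least bs≤a))

      μ^-∧-invariant : ∀ y x → a ≤ y → InMinDown i x →
        μ^ R 𝔸 μ a bs x ℝ.≈ μ^ R 𝔸 μ a bs (x ∧ y)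
      μ^-∧-invariant y x a≤y dx = begin
        μ^ R 𝔸 μ a bs x
          ≈⟨ μ^≈difference dx ⟩
        μ (x ∧ a) ℝ.- μ (x ∧ ⋁ bs)
          ≈⟨ ℝ.+-cong (μ-∧-absorb a≤y dx) (ℝ.-‿cong (μ-∧-absorb (trans (⋁-least bs≤a) a≤y) dx)) ⟩
        μ ((x ∧ y) ∧ a) ℝ.- μ ((x ∧ y) ∧ ⋁ bs)
          ≈⟨ ℝ.sym (μ^≈difference (InMinDown-≤ (x∧y≤x x y) dx)) ⟩
        μ^ R 𝔸 μ a bs (x ∧ y) ∎
        where open ≈-Reasoning ℝ.setoid

module MaximalBelow {Ag : Set} (R : RealNumbers) (𝔸 : EpistemicHA Ag)
    (𝔼 : ProbEventStructure R 𝔸) (a : EpistemicHA.Carrier 𝔸) where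
  open EpistemicHA 𝔸
  open ProbEventStructure 𝔼
  open LatticeProperties HA
  open import Relation.Binary.Properties.Poset poset using (<-resp-≈)

  <-resp₂-≈ : ∀ {x y x′ y′} → x ≈ x′ → y ≈ y′ → x < y → x′ < y′
  <-resp₂-≈ x≈x′ y≈y′ = proj₁ <-resp-≈ y≈y′ ∘ proj₂ <-resp-≈ x≈x′

  -- Φ-ok leaves disjointness as the only option: comparability would contradict maximality.
  InMb-disjoint : ∀ {b c} → InMb a b → InMb a c → ¬ (b ≈ c) → Disjoint b c
  InMb-disjoint {b} {c} ((kb , Φkb≈b) , b<a , b-max) ((kc , Φkc≈c) , c<a , c-max) b≉c
    with Φ-ok kb kc (λ Φkb≈Φkc → b≉c (Eq.trans (Eq.sym Φkb≈b) (Eq.trans Φkb≈Φkc Φkc≈c)))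
  ... | inj₁ Φkb∧Φkc≈⊥ = trans (∧-monotonic (reflexive (Eq.sym Φkb≈b)) (reflexive (Eq.sym Φkc≈c)))
                                (reflexive Φkb∧Φkc≈⊥)
  ... | inj₂ (inj₁ Φkb<Φkc) = ⊥-elim (b-max c (kc , Φkc≈c) c<a (<-resp₂-≈ Φkb≈b Φkc≈c Φkb<Φkc))
  ... | inj₂ (inj₂ Φkc<Φkb) = ⊥-elim (c-max b (kb , Φkb≈b) b<a (<-resp₂-≈ Φkc≈c Φkb≈b Φkc<Φkb))

  module _ {bs : List Carrier} (enum : Enumerates R 𝔸 (InMb a) bs) where

    enumerated-InMb : All (InMb a) bs
    enumerated-InMb = All.tabulateₛ setoid (λ {b} → Equivalence.from (proj₂ enum b))

    enumerated-≤ : All (_≤ a) bs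
    enumerated-≤ = All.map (λ (_ , b<a , _) → proj₁ b<a) enumerated-InMb

    enumerated-disjoint : AllPairs Disjoint bs
    enumerated-disjoint = pairwise enumerated-InMb (proj₁ enum)
      where
      pairwise : ∀ {cs} → All (InMb a) cs → AllPairs (λ b c → ¬ (b ≈ c)) cs → AllPairs Disjoint cs
      pairwise []            []            = []
      pairwise (c-mb ∷ cs-mb) (c≉cs ∷ cs-≉) =
        All.zipWith (λ (d-mb , c≉d) → InMb-disjoint c-mb d-mb c≉d) (cs-mb , c≉cs)
        ∷ pairwise cs-mb cs-≉

proposition5 : {Ag : Set} (R : RealNumbers) (𝔸 : EpistemicHA Ag)
    (ℱ : APE R 𝔸) (𝔼 : ProbEventStructure R 𝔸)
    (k : Fin (length (ProbEventStructure.Φ 𝔼))) (i : Ag)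
    (bs : List (EpistemicHA.Carrier 𝔸)) →
    Enumerates R 𝔸 (ProbEventStructure.InMb 𝔼 (lookup (ProbEventStructure.Φ 𝔼) k)) bs →
    IsPremeasure R 𝔸 i (μ^ R 𝔸 (APE.μ ℱ i) (lookup (ProbEventStructure.Φ 𝔼) k) bs)
    × (∀ (y x : EpistemicHA.Carrier 𝔸) →
       EpistemicHA._≤_ 𝔸 (lookup (ProbEventStructure.Φ 𝔼) k) y →
       EpistemicHA.InMinDown 𝔸 i x →
       RealNumbers._≈_ R
         (μ^ R 𝔸 (APE.μ ℱ i) (lookup (ProbEventStructure.Φ 𝔼) k) bs x)
         (μ^ R 𝔸 (APE.μ ℱ i) (lookup (ProbEventStructure.Φ 𝔼) k) bs
           (EpistemicHA._∧_ 𝔸 x y)))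
proposition5 R 𝔸 ℱ 𝔼 k i bs enum = μ^-isPremeasure , μ^-∧-invariant
  where
  open MaximalBelow R 𝔸 𝔼 (lookup (ProbEventStructure.Φ 𝔼) k)
  open PremeasureProperties.μ^-Properties R 𝔸 i (IsMeasure.isPremeasure (APE.isMeasure ℱ i))
    (enumerated-disjoint enum) (enumerated-≤ enum)
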